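{- Let $d\ge0$ and $\mathbb{F}$ a field. Let $\mathcal{T}_d(\mathbb{F})$ be the set of very good upper triangular matrices in ${\rm Mat}_{d+1}(\mathbb{F})$, with equivalence relation $T\sim T'$ iff $T'=HTK$ for some invertible diagonal $H,K\in{\rm Mat}_{d+1}(\mathbb{F})$. Then each $\sim$-equivalence class contains a unique nice element, where $T\in\mathcal{T}_d(\mathbb{F})$ is nice if $T_{0i}=T_{ii}=1$ for all $0\le i\le d$.
   Context: Matrices are indexed by $0,\dots,d$; for $0\le i\le j\le d$, $T[i,j]$ is the submatrix with rows $0,\dots,j-i$ and columns $i,\dots,j$; $T$ is very good if every $T[i,j]$ is invertible. -}

module Defs where

open import Level using (_⊔_) renaming (suc to lsuc)
open import Algebra.Bundles using (CommutativeRing)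
open import Data.Nat as ℕ using (ℕ; zero; suc; _∸_; _≤_; _<_; s≤s)
open import Data.Nat.Properties using (m∸n≤m; ≤-trans; ≤-reflexive; m+[n∸m]≡n; +-monoʳ-≤)
open import Data.Fin using (Fin; toℕ; fromℕ<; _≟_)
open import Data.Fin.Properties using (toℕ<n)
open import Data.Product using (Σ; ∃; _×_)
open import Relation.Nullary using (¬_; yes; no)
open import Relation.Binary.PropositionalEquality using (_≢_)

record Field (c ℓ : Level.Level) : Set (lsuc (c ⊔ ℓ)) where
  field
    commutativeRing : CommutativeRing c ℓ
  open CommutativeRing commutativeRing public
  field
    0≉1     : ¬ (0# ≈ 1#)
    inverse : ∀ x → ¬ (x ≈ 0#) → Σ Carrier λ y → x * y ≈ 1#

module FieldDefs {c ℓ} (F : Field c ℓ) where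
  open Field F

  Mat : ℕ → Set c
  Mat n = Fin n → Fin n → Carrier

  _≈ᴹ_ : ∀ {n} → Mat n → Mat n → Set ℓ
  A ≈ᴹ B = ∀ r s → A r s ≈ B r s

  Σ[_] : ∀ n → (Fin n → Carrier) → Carrier
  Σ[ zero ] f = 0#
  Σ[ suc n ] f = f Fin.zero + Σ[ n ] (λ i → f (Fin.suc i))

  _*ᴹ_ : ∀ {n} → Mat n → Mat n → Mat n
  _*ᴹ_ {n} A B r s = Σ[ n ] (λ k → A r k * B k s)

  Iᴹ : ∀ {n} → Mat n
  Iᴹ r s with r ≟ s
  ... | yes _ = 1#
  ... | no _  = 0#

  Invertible : ∀ {n} → Mat n → Set (c ⊔ ℓ)
  Invertible {n} A = Σ (Mat n) λ B → ((A *ᴹ B) ≈ᴹ Iᴹ) × ((B *ᴹ A) ≈ᴹ Iᴹ)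

  Diagonal : ∀ {n} → Mat n → Set ℓ
  Diagonal A = ∀ r s → r ≢ s → A r s ≈ 0#

  UpperTriangular : ∀ {n} → Mat n → Set ℓ
  UpperTriangular A = ∀ r s → toℕ s < toℕ r → A r s ≈ 0#

  -- T[i,j] for i ≤ j: rows 0,…,j-i and columns i,…,j of a (d+1)×(d+1) matrix
  private
    rowBound : ∀ {d} (i j : Fin (suc d)) (r : Fin (suc (toℕ j ∸ toℕ i))) → toℕ r < suc d
    rowBound i j r = ≤-trans (toℕ<n r) (s≤s (≤-trans (m∸n≤m (toℕ j) (toℕ i)) (Data.Nat.Properties.≤-pred (toℕ<n j))))

    colBound : ∀ {d} (i j : Fin (suc d)) → toℕ i ≤ toℕ j → (s : Fin (suc (toℕ j ∸ toℕ i))) → toℕ i ℕ.+ toℕ s < suc d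
    colBound i j i≤j s = ≤-trans (s≤s (≤-trans (+-monoʳ-≤ (toℕ i) (Data.Nat.Properties.≤-pred (toℕ<n s))) (≤-reflexive (m+[n∸m]≡n i≤j)))) (toℕ<n j)

  sub : ∀ {d} → Mat (suc d) → (i j : Fin (suc d)) → toℕ i ≤ toℕ j → Mat (suc (toℕ j ∸ toℕ i))
  sub T i j i≤j r s = T (fromℕ< (rowBound i j r)) (fromℕ< (colBound i j i≤j s))

  VeryGood : ∀ {d} → Mat (suc d) → Set (c ⊔ ℓ)
  VeryGood {d} T = ∀ (i j : Fin (suc d)) (i≤j : toℕ i ≤ toℕ j) → Invertible (sub T i j i≤j)

  InTd : ∀ {d} → Mat (suc d) → Set (c ⊔ ℓ)
  InTd T = VeryGood T × UpperTriangular T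

  _∼_ : ∀ {n} → Mat n → Mat n → Set (c ⊔ ℓ)
  _∼_ {n} T T' = Σ (Mat n) λ H → Σ (Mat n) λ K →
    Diagonal H × Invertible H × Diagonal K × Invertible K × (T' ≈ᴹ ((H *ᴹ T) *ᴹ K))

  Nice : ∀ {d} → Mat (suc d) → Set ℓ
  Nice T = ∀ i → (T Fin.zero i ≈ 1#) × (T i i ≈ 1#)

module Submission where

-- Write  scale a T b  for the matrix (a r * T r s * b s), i.e. H T K with
-- H = diag a and K = diag b.  If T is very good and upper triangular, every
-- first-row entry T₀ₛ is a unit (it is the 1×1 block T[s,s]) and every diagonal
-- entry Tₛₛ is a unit (it is the last diagonal entry of the invertible upper
-- triangular block T[0,s]).  Hence
--      N = scale h T k   with   h r = T₀ᵣ / Tᵣᵣ ,  k s = 1 / T₀ₛ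
-- is nice, and very good because each block of N is a scaling of the
-- corresponding block of T by units.  Conversely, if scale a T b is nice, the
-- niceness equations at (r,r), (0,s) and (0,r) force a r * b s = T₀ᵣ / (Tᵣᵣ T₀ₛ),
-- so every nice matrix equivalent to T coincides with N.

open import Defs
open import Level using (_⊔_)
open import Data.Nat as ℕ using (ℕ; suc; _<_; z≤n)
import Data.Nat.Properties as ℕP
open import Data.Fin as Fin using (Fin; toℕ; fromℕ; _≟_)
open import Data.Fin.Properties using (toℕ-fromℕ<; toℕ-injective; toℕ-fromℕ; toℕ<n; suc-injective)
open import Data.Product using (Σ; _×_; _,_; proj₁; proj₂)
open import Data.Empty using (⊥-elim)
open import Relation.Nullary using (yes; no)
import Relation.Binary.PropositionalEquality as P
open P using (_≡_; _≢_)
import Algebra.Solver.CommutativeMonoid as CMS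

module Theory {c ℓ} (F : Field c ℓ) where
  open Field F
  open FieldDefs F
  open import Relation.Binary.Reasoning.Setoid setoid
  module S = CMS *-commutativeMonoid
  open S using (_⊕_; _⊜_)

  Unit : Carrier → Set (c ⊔ ℓ)
  Unit x = Σ Carrier λ z → x * z ≈ 1#

  Σ-cong : ∀ n {f g : Fin n → Carrier} → (∀ k → f k ≈ g k) → Σ[ n ] f ≈ Σ[ n ] g
  Σ-cong ℕ.zero  eq = refl
  Σ-cong (suc n) eq = +-cong (eq Fin.zero) (Σ-cong n (λ k → eq (Fin.suc k)))

  Σ-zero : ∀ n → Σ[ n ] (λ _ → 0#) ≈ 0#
  Σ-zero ℕ.zero  = refl
  Σ-zero (suc n) = trans (+-identityˡ _) (Σ-zero n)

  Σ-single : ∀ n (f : Fin n → Carrier) (r : Fin n) → (∀ k → k ≢ r → f k ≈ 0#) → Σ[ n ] f ≈ f r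
  Σ-single (suc n) f Fin.zero vanish =
    trans (+-congˡ (trans (Σ-cong n (λ k → vanish (Fin.suc k) (λ ()))) (Σ-zero n))) (+-identityʳ _)
  Σ-single (suc n) f (Fin.suc r) vanish =
    trans (+-cong (vanish Fin.zero (λ ()))
                  (Σ-single n (λ k → f (Fin.suc k)) r (λ k k≢r → vanish (Fin.suc k) (λ e → k≢r (suc-injective e)))))
          (+-identityˡ _)

  Σ-*ˡ : ∀ n x (f : Fin n → Carrier) → Σ[ n ] (λ k → x * f k) ≈ x * Σ[ n ] f
  Σ-*ˡ ℕ.zero  x f = sym (zeroʳ x)
  Σ-*ˡ (suc n) x f = trans (+-congˡ (Σ-*ˡ n x (λ k → f (Fin.suc k)))) (sym (distribˡ x _ _))

  Σ-*ʳ : ∀ n x (f : Fin n → Carrier) → Σ[ n ] (λ k → f k * x) ≈ Σ[ n ] f * x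
  Σ-*ʳ ℕ.zero  x f = sym (zeroˡ x)
  Σ-*ʳ (suc n) x f = trans (+-congˡ (Σ-*ʳ n x (λ k → f (Fin.suc k)))) (sym (distribʳ x _ _))

  Iᴹ-diag : ∀ {n} (r : Fin n) → Iᴹ r r ≈ 1#
  Iᴹ-diag r with r ≟ r
  ... | yes _   = refl
  ... | no r≢r = ⊥-elim (r≢r P.refl)

  scale : ∀ {n} → (Fin n → Carrier) → Mat n → (Fin n → Carrier) → Mat n
  scale a B b r s = a r * B r s * b s

  diagonal-sandwich : ∀ {n} (H T K : Mat n) → Diagonal H → Diagonal K →
    ((H *ᴹ T) *ᴹ K) ≈ᴹ scale (λ r → H r r) T (λ s → K s s)
  diagonal-sandwich {n} H T K dH dK r s = begin
    Σ[ n ] (λ k → (H *ᴹ T) r k * K k s)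
      ≈⟨ Σ-single n _ s (λ k k≢s → trans (*-congˡ (dK k s k≢s)) (zeroʳ _)) ⟩
    (H *ᴹ T) r s * K s s
      ≈⟨ *-congʳ (Σ-single n _ r (λ k k≢r → trans (*-congʳ (dH r k (λ e → k≢r (P.sym e)))) (zeroˡ _))) ⟩
    H r r * T r s * K s s ∎

  diag : ∀ {n} → (Fin n → Carrier) → Mat n
  diag f r s with r ≟ s
  ... | yes _ = f r
  ... | no _  = 0#

  diag-diagonal : ∀ {n} (f : Fin n → Carrier) → Diagonal (diag f)
  diag-diagonal f r s r≢s with r ≟ s
  ... | yes r≡s = ⊥-elim (r≢s r≡s)
  ... | no _    = refl

  diag-on-diagonal : ∀ {n} (f : Fin n → Carrier) r → diag f r r ≈ f r
  diag-on-diagonal f r with r ≟ r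
  ... | yes _   = refl
  ... | no r≢r = ⊥-elim (r≢r P.refl)

  diag-inverse : ∀ {n} (f g : Fin n → Carrier) → (∀ r → f r * g r ≈ 1#) → (diag f *ᴹ diag g) ≈ᴹ Iᴹ
  diag-inverse {n} f g fg r s =
    trans (Σ-single n _ r (λ k k≢r → trans (*-congʳ (diag-diagonal f r k (λ e → k≢r (P.sym e)))) (zeroˡ _)))
          (trans (*-congʳ (diag-on-diagonal f r)) corner)
    where
    corner : f r * diag g r s ≈ Iᴹ r s
    corner with r ≟ s
    ... | yes P.refl = fg r
    ... | no _       = zeroʳ _

  diag-invertible : ∀ {n} (f g : Fin n → Carrier) → (∀ r → f r * g r ≈ 1#) → Invertible (diag f)
  diag-invertible f g fg = diag g , diag-inverse f g fg , diag-inverse g f (λ r → trans (*-comm _ _) (fg r))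

  scale-right-inverse : ∀ {n} (P′ Q : Mat n) → (P′ *ᴹ Q) ≈ᴹ Iᴹ → (p p⁻¹ q q⁻¹ : Fin n → Carrier) →
    (∀ r → p r * p⁻¹ r ≈ 1#) → (∀ k → q k * q⁻¹ k ≈ 1#) →
    (scale p P′ q *ᴹ scale q⁻¹ Q p⁻¹) ≈ᴹ Iᴹ
  scale-right-inverse {n} P′ Q PQ p p⁻¹ q q⁻¹ pp qq r s = begin
    Σ[ n ] (λ k → (p r * P′ r k * q k) * (q⁻¹ k * Q k s * p⁻¹ s))
      ≈⟨ Σ-cong n cancel-q ⟩
    Σ[ n ] (λ k → p r * ((P′ r k * Q k s) * p⁻¹ s))
      ≈⟨ Σ-*ˡ n (p r) _ ⟩
    p r * Σ[ n ] (λ k → (P′ r k * Q k s) * p⁻¹ s)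
      ≈⟨ *-congˡ (Σ-*ʳ n (p⁻¹ s) _) ⟩
    p r * ((P′ *ᴹ Q) r s * p⁻¹ s)
      ≈⟨ *-congˡ (*-congʳ (PQ r s)) ⟩
    p r * (Iᴹ r s * p⁻¹ s)
      ≈⟨ cancel-p ⟩
    Iᴹ r s ∎
    where
    cancel-q : ∀ k → (p r * P′ r k * q k) * (q⁻¹ k * Q k s * p⁻¹ s) ≈ p r * ((P′ r k * Q k s) * p⁻¹ s)
    cancel-q k = trans (S.solve 6 (λ a b c′ d′ e f →
                          ((a ⊕ b) ⊕ c′) ⊕ ((d′ ⊕ e) ⊕ f) ⊜ (a ⊕ ((b ⊕ e) ⊕ f)) ⊕ (c′ ⊕ d′))
                          refl (p r) (P′ r k) (q k) (q⁻¹ k) (Q k s) (p⁻¹ s))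
                       (trans (*-congˡ (qq k)) (*-identityʳ _))
    cancel-p : p r * (Iᴹ r s * p⁻¹ s) ≈ Iᴹ r s
    cancel-p with r ≟ s
    ... | yes P.refl = trans (*-congˡ (*-identityˡ _)) (pp r)
    ... | no _       = trans (*-congˡ (zeroˡ _)) (zeroʳ _)

  scale-invertible : ∀ {n} (B : Mat n) → Invertible B → (a a⁻¹ b b⁻¹ : Fin n → Carrier) →
    (∀ r → a r * a⁻¹ r ≈ 1#) → (∀ r → b r * b⁻¹ r ≈ 1#) → Invertible (scale a B b)
  scale-invertible B (B′ , BB′ , B′B) a a⁻¹ b b⁻¹ aa bb =
    scale b⁻¹ B′ a⁻¹ ,
    scale-right-inverse B B′ BB′ a a⁻¹ b b⁻¹ aa bb ,
    scale-right-inverse B′ B B′B b⁻¹ b a⁻¹ a (λ r → trans (*-comm _ _) (bb r)) (λ r → trans (*-comm _ _) (aa r))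

  -- In an invertible matrix, an entry whose row vanishes elsewhere is a unit:
  -- the (p,p) entry of A B = I is A p p * B p p.
  isolated-entry-unit : ∀ {n} (A : Mat n) (p : Fin n) → (∀ k → k ≢ p → A p k ≈ 0#) →
    Invertible A → Unit (A p p)
  isolated-entry-unit {n} A p vanish (B , AB , _) =
    B p p , trans (sym (Σ-single n _ p (λ k k≢p → trans (*-congʳ (vanish k k≢p)) (zeroˡ _))))
                  (trans (AB p p) (Iᴹ-diag p))

  below-last : ∀ m (k : Fin (suc m)) → k ≢ fromℕ m → toℕ k < toℕ (fromℕ m)
  below-last m k k≢last = P.subst (toℕ k <_) (P.sym (toℕ-fromℕ m))
    (ℕP.≤∧≢⇒< (ℕP.≤-pred (toℕ<n k)) (λ e → k≢last (toℕ-injective (P.trans e (P.sym (toℕ-fromℕ m))))))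

  last-diagonal-unit : ∀ m (A : Mat (suc m)) → UpperTriangular A → Invertible A →
    Unit (A (fromℕ m) (fromℕ m))
  last-diagonal-unit m A ut = isolated-entry-unit A (fromℕ m) (λ k k≢last → ut (fromℕ m) k (below-last m k k≢last))

  only-index : ∀ {m} → m ≡ 0 → (k : Fin (suc m)) → k ≡ Fin.zero
  only-index P.refl Fin.zero = P.refl

  sub-entry : ∀ {d} (T : Mat (suc d)) i j i≤j r s (x y : Fin (suc d)) →
    toℕ x ≡ toℕ r → toℕ y ≡ toℕ i ℕ.+ toℕ s → sub T i j i≤j r s ≡ T x y
  sub-entry T i j i≤j r s x y x≡r y≡i+s =
    P.cong₂ T (toℕ-injective (P.trans (toℕ-fromℕ< _) (P.sym x≡r)))
              (toℕ-injective (P.trans (toℕ-fromℕ< _) (P.sym y≡i+s)))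

  leading-block-upper : ∀ {d} (T : Mat (suc d)) j → UpperTriangular T → UpperTriangular (sub T Fin.zero j z≤n)
  leading-block-upper T j ut r s s<r =
    ut _ _ (P.subst₂ _<_ (P.sym (toℕ-fromℕ< _)) (P.sym (toℕ-fromℕ< _)) s<r)

  -- First-row entries of a very good matrix are units: T₀ₛ is the block T[s,s].
  first-row-unit : ∀ {d} (T : Mat (suc d)) → VeryGood T → ∀ s → Unit (T Fin.zero s)
  first-row-unit T vg s =
    P.subst Unit (sub-entry T s s ℕP.≤-refl Fin.zero Fin.zero Fin.zero s P.refl (P.sym (ℕP.+-identityʳ _)))
      (isolated-entry-unit (sub T s s ℕP.≤-refl) Fin.zero
        (λ k k≢0 → ⊥-elim (k≢0 (only-index (ℕP.n∸n≡0 (toℕ s)) k)))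
        (vg s s ℕP.≤-refl))

  -- Diagonal entries of a very good upper triangular matrix are units:
  -- Tₛₛ is the last diagonal entry of the upper triangular block T[0,s].
  diagonal-unit : ∀ {d} (T : Mat (suc d)) → VeryGood T → UpperTriangular T → ∀ s → Unit (T s s)
  diagonal-unit T vg ut s =
    P.subst Unit (sub-entry T Fin.zero s z≤n last last s s (P.sym (toℕ-fromℕ _)) (P.sym (toℕ-fromℕ _)))
      (last-diagonal-unit (toℕ s) (sub T Fin.zero s z≤n) (leading-block-upper T s ut) (vg Fin.zero s z≤n))
    where last = fromℕ (toℕ s)

  NiceScaling : ∀ {d} → Mat (suc d) → (a b : Fin (suc d) → Carrier) → Set ℓ
  NiceScaling T a b = ∀ s → (a Fin.zero * T Fin.zero s * b s ≈ 1#) × (a s * T s s * b s ≈ 1#)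

  -- Niceness determines the products of the scaling factors:
  -- a r * b s = T₀ᵣ / (Tᵣᵣ T₀ₛ).  Multiply a r * b s by the three units
  -- a₀T₀ᵣbᵣ, Tᵣᵣz, T₀ₛw and regroup as (aᵣTᵣᵣbᵣ)(a₀T₀ₛbₛ)T₀ᵣzw.
  scaling-factors-determined : ∀ {d} (T : Mat (suc d)) (a b : Fin (suc d) → Carrier) →
    NiceScaling T a b → ∀ r s {z w} → T r r * z ≈ 1# → T Fin.zero s * w ≈ 1# →
    a r * b s ≈ T Fin.zero r * z * w
  scaling-factors-determined T a b nice r s {z} {w} Tz Tw = begin
    a r * b s                                                   ≈⟨ sym (times-ones (a r * b s)) ⟩
    a r * b s * (a₀ * T₀r * b r) * (Trr * z) * (T₀s * w)        ≈⟨ S.solve 9 (λ ar bs br a₀ T₀r T₀s Trr z w →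
        ((((ar ⊕ bs) ⊕ ((a₀ ⊕ T₀r) ⊕ br)) ⊕ (Trr ⊕ z)) ⊕ (T₀s ⊕ w))
          ⊜ ((((ar ⊕ Trr) ⊕ br) ⊕ ((a₀ ⊕ T₀s) ⊕ bs)) ⊕ ((T₀r ⊕ z) ⊕ w)))
        refl (a r) (b s) (b r) a₀ T₀r T₀s Trr z w ⟩
    (a r * Trr * b r) * (a₀ * T₀s * b s) * (T₀r * z * w)        ≈⟨ *-congʳ (*-cong (proj₂ (nice r)) (proj₁ (nice s))) ⟩
    1# * 1# * (T₀r * z * w)                                     ≈⟨ trans (*-congʳ (*-identityˡ _)) (*-identityˡ _) ⟩
    T₀r * z * w ∎
    where
    a₀ = a Fin.zero
    T₀r = T Fin.zero r
    T₀s = T Fin.zero s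
    Trr = T r r
    times-ones : ∀ x → x * (a₀ * T₀r * b r) * (Trr * z) * (T₀s * w) ≈ x
    times-ones x = trans (*-cong (*-cong (*-congˡ (proj₁ (nice r))) Tz) Tw)
                         (trans (*-identityʳ _) (trans (*-identityʳ _) (*-identityʳ _)))

  module NormalForm {d : ℕ} (T : Mat (suc d))
                    (first-row : ∀ s → Unit (T Fin.zero s)) (diagonal : ∀ s → Unit (T s s)) where

    T₀⁻¹ Tᵈ⁻¹ rowFactor rowFactor⁻¹ colFactor : Fin (suc d) → Carrier
    T₀⁻¹ s = proj₁ (first-row s)
    Tᵈ⁻¹ s = proj₁ (diagonal s)
    rowFactor r = T Fin.zero r * Tᵈ⁻¹ r
    rowFactor⁻¹ r = T₀⁻¹ r * T r r
    colFactor s = T₀⁻¹ s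

    rowFactor-unit : ∀ r → rowFactor r * rowFactor⁻¹ r ≈ 1#
    rowFactor-unit r =
      trans (S.solve 4 (λ a b c′ e → (a ⊕ b) ⊕ (c′ ⊕ e) ⊜ (a ⊕ c′) ⊕ (e ⊕ b)) refl
               (T Fin.zero r) (Tᵈ⁻¹ r) (T₀⁻¹ r) (T r r))
            (trans (*-cong (proj₂ (first-row r)) (proj₂ (diagonal r))) (*-identityˡ _))

    colFactor-unit : ∀ s → colFactor s * T Fin.zero s ≈ 1#
    colFactor-unit s = trans (*-comm _ _) (proj₂ (first-row s))

    N : Mat (suc d)
    N = scale rowFactor T colFactor

    N-nice : Nice N
    N-nice i =
      trans (S.solve 4 (λ a b c′ e → ((a ⊕ b) ⊕ c′) ⊕ e ⊜ (a ⊕ b) ⊕ (c′ ⊕ e)) refl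
               (T Fin.zero Fin.zero) (Tᵈ⁻¹ Fin.zero) (T Fin.zero i) (T₀⁻¹ i))
        (trans (*-cong (proj₂ (diagonal Fin.zero)) (proj₂ (first-row i))) (*-identityˡ _)) ,
      trans (S.solve 4 (λ a b c′ e → ((a ⊕ b) ⊕ c′) ⊕ e ⊜ (a ⊕ e) ⊕ (c′ ⊕ b)) refl
               (T Fin.zero i) (Tᵈ⁻¹ i) (T i i) (T₀⁻¹ i))
        (trans (*-cong (proj₂ (first-row i)) (proj₂ (diagonal i))) (*-identityˡ _))

    N-upper : UpperTriangular T → UpperTriangular N
    N-upper ut r s s<r = trans (*-congʳ (trans (*-congˡ (ut r s s<r)) (zeroʳ _))) (zeroˡ _)

    -- Each block of N is the corresponding block of T scaled by units
    -- (restricting the factors to the rows, resp. columns, of the block).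
    N-very-good : VeryGood T → VeryGood N
    N-very-good vg i j i≤j = scale-invertible (sub T i j i≤j) (vg i j i≤j)
      (restrictRows rowFactor) (restrictRows rowFactor⁻¹) (restrictCols colFactor) (restrictCols (T Fin.zero))
      (λ _ → rowFactor-unit _) (λ _ → colFactor-unit _)
      where
      restrictRows restrictCols : (Fin (suc d) → Carrier) → Fin _ → Carrier
      restrictRows f r = sub (λ x _ → f x) i j i≤j r Fin.zero
      restrictCols f s = sub (λ _ y → f y) i j i≤j Fin.zero s

    T∼N : T ∼ N
    T∼N = diag rowFactor , diag colFactor ,
          diag-diagonal rowFactor , diag-invertible rowFactor rowFactor⁻¹ rowFactor-unit ,
          diag-diagonal colFactor , diag-invertible colFactor (T Fin.zero) colFactor-unit ,
          λ r s → sym (trans (diagonal-sandwich (diag rowFactor) T (diag colFactor)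
                                (diag-diagonal rowFactor) (diag-diagonal colFactor) r s)
                             (*-cong (*-congʳ (diag-on-diagonal rowFactor r)) (diag-on-diagonal colFactor s)))

    nice-equivalent-is-N : ∀ M → T ∼ M → Nice M → M ≈ᴹ N
    nice-equivalent-is-N M (H , K , dH , _ , dK , _ , M≈HTK) nice r s = begin
      M r s                  ≈⟨ M≈scaling r s ⟩
      a r * T r s * b s      ≈⟨ swap (a r) (T r s) (b s) ⟩
      (a r * b s) * T r s    ≈⟨ *-congʳ (scaling-factors-determined T a b nice-scaling r s
                                          (proj₂ (diagonal r)) (proj₂ (first-row s))) ⟩
      rowFactor r * T₀⁻¹ s * T r s
        ≈⟨ sym (swap (rowFactor r) (T r s) (colFactor s)) ⟩
      N r s ∎
      where
      a b : Fin (suc d) → Carrier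
      a x = H x x
      b x = K x x
      M≈scaling : M ≈ᴹ scale a T b
      M≈scaling x y = trans (M≈HTK x y) (diagonal-sandwich H T K dH dK x y)
      nice-scaling : NiceScaling T a b
      nice-scaling x = trans (sym (M≈scaling Fin.zero x)) (proj₁ (nice x)) ,
                       trans (sym (M≈scaling x x)) (proj₂ (nice x))
      swap : ∀ x y z → x * y * z ≈ x * z * y
      swap = S.solve 3 (λ x y z → (x ⊕ y) ⊕ z ⊜ (x ⊕ z) ⊕ y) refl

lemma7p6 : ∀ {c ℓ} (F : Field c ℓ) (d : ℕ) → let open FieldDefs F in
    ∀ (T : Mat (suc d)) → InTd T →
    Σ (Mat (suc d)) (λ N → InTd N × (T ∼ N) × Nice N)
    × (∀ (N₁ N₂ : Mat (suc d)) → InTd N₁ → T ∼ N₁ → Nice N₁ → InTd N₂ → T ∼ N₂ → Nice N₂ → N₁ ≈ᴹ N₂)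
lemma7p6 F d T (vg , ut) =
  (N , (N-very-good vg , N-upper ut) , T∼N , N-nice) ,
  λ N₁ N₂ _ T∼N₁ nice₁ _ T∼N₂ nice₂ r s →
    trans (nice-equivalent-is-N N₁ T∼N₁ nice₁ r s) (sym (nice-equivalent-is-N N₂ T∼N₂ nice₂ r s))
  where
  open Field F using (trans; sym)
  open Theory F
  open NormalForm T (first-row-unit T vg) (diagonal-unit T vg ut)
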